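{- Let $k\in\mathbb{N}$ and let $G$ be a $k$-tree on $n$ vertices. Then $$\gamma_i(G)\leq \frac{n+|V_k^G|}{k+2},$$ where $V_k^G=\{v\in V(G): \deg_G(v)=k\}$. Furthermore, this bound is tight: for every $k\in\mathbb{N}$ there exist $k$-trees $G$ for which equality holds.
   Context: All graphs are simple and finite. For $k\in\mathbb{N}$, a $k$-tree is defined recursively: the complete graph $K_{k+1}$ is a $k$-tree, and if $G$ is a $k$-tree then the graph obtained by adding a new vertex and joining it to all vertices of some $k$-clique (complete subgraph on $k$ vertices) of $G$ is a $k$-tree. A set $D\subseteq V(G)$ is dominating if every vertex of $V(G)\setminus D$ is adjacent to a vertex of $D$; the independent domination number $\gamma_i(G)$ is the minimum cardinality of a set that is both independent and dominating in $G$. -}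

module Defs where

open import Data.Nat using (ℕ; zero; suc; _+_; _*_; _≤_; _≡ᵇ_)
open import Data.Bool using (Bool; true; false; not; if_then_else_)
open import Data.Fin using (Fin; zero; suc; _≟_)
open import Data.Fin.Permutation using (Permutation′; _⟨$⟩ʳ_)
open import Data.Product using (Σ; _×_; _,_)
open import Relation.Nullary using (does; ¬_)
open import Relation.Binary.PropositionalEquality using (_≡_; refl)

record Graph (n : ℕ) : Set where
  field
    adj    : Fin n → Fin n → Bool
    sym    : ∀ u v → adj u v ≡ adj v u
    irrefl : ∀ v → adj v v ≡ false
open Graph public

count : ∀ {n} → (Fin n → Bool) → ℕ
count {zero}  P = 0
count {suc n} P = (if P zero then 1 else 0) + count (λ i → P (suc i))

deg : ∀ {n} → Graph n → Fin n → ℕ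
deg G v = count (adj G v)

numDeg : ∀ {n} → Graph n → ℕ → ℕ
numDeg G k = count (λ v → deg G v ≡ᵇ k)

complete : (m : ℕ) → Graph m
complete m = record { adj = λ u v → not (does (u ≟ v)) ; sym = s ; irrefl = i }
  where
  s : ∀ {m} (u v : Fin m) → not (does (u ≟ v)) ≡ not (does (v ≟ u))
  s zero zero = refl
  s zero (suc v) = refl
  s (suc u) zero = refl
  s (suc u) (suc v) with u ≟ v | v ≟ u
  ... | Relation.Nullary.yes p | Relation.Nullary.yes q = refl
  ... | Relation.Nullary.yes refl | Relation.Nullary.no q with q refl
  ... | ()
  s (suc u) (suc v) | Relation.Nullary.no p | Relation.Nullary.yes refl with p refl
  ... | ()
  s (suc u) (suc v) | Relation.Nullary.no p | Relation.Nullary.no q = refl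
  i : ∀ {m} (v : Fin m) → not (does (v ≟ v)) ≡ false
  i zero = refl
  i (suc v) with v ≟ v
  ... | Relation.Nullary.yes _ = refl
  ... | Relation.Nullary.no ¬p with ¬p refl
  ... | ()

IsClique : ∀ {n} → Graph n → ℕ → (Fin n → Bool) → Set
IsClique G k C =
  count C ≡ k ×
  (∀ u v → C u ≡ true → C v ≡ true → ¬ (u ≡ v) → adj G u v ≡ true)

extend : ∀ {n} → Graph n → (Fin n → Bool) → Graph (suc n)
extend {n} G C = record { adj = a ; sym = s ; irrefl = i }
  where
  a : Fin (suc n) → Fin (suc n) → Bool
  a zero zero = false
  a zero (suc v) = C v
  a (suc u) zero = C u
  a (suc u) (suc v) = adj G u v
  s : ∀ u v → a u v ≡ a v u
  s zero zero = refl
  s zero (suc v) = refl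
  s (suc u) zero = refl
  s (suc u) (suc v) = Graph.sym G u v
  i : ∀ v → a v v ≡ false
  i zero = refl
  i (suc v) = irrefl G v

-- k-trees, defined recursively as in the paper; the last constructor
-- closes the class under isomorphism (relabelling of vertices), since
-- "the graph obtained by adding a new vertex" is only defined up to
-- the name of the new vertex.
data KTree (k : ℕ) : ∀ {n} → Graph n → Set where
  base : KTree k (complete (suc k))
  step : ∀ {n} {G : Graph n} (C : Fin n → Bool) →
         KTree k G → IsClique G k C → KTree k (extend G C)
  iso  : ∀ {n} {G H : Graph n} (π : Permutation′ n) →
         KTree k G →
         (∀ u v → adj H u v ≡ adj G (π ⟨$⟩ʳ u) (π ⟨$⟩ʳ v)) →
         KTree k H

Independent : ∀ {n} → Graph n → (Fin n → Bool) → Set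
Independent G D = ∀ u v → D u ≡ true → D v ≡ true → adj G u v ≡ false

Dominating : ∀ {n} → Graph n → (Fin n → Bool) → Set
Dominating G D = ∀ v → D v ≡ false → Σ _ λ u → D u ≡ true × adj G u v ≡ true

IndepDom : ∀ {n} → Graph n → (Fin n → Bool) → Set
IndepDom G D = Independent G D × Dominating G D

IsIndepDomNumber : ∀ {n} → Graph n → ℕ → Set
IsIndepDomNumber G m =
  (Σ _ λ D → IndepDom G D × count D ≡ m) ×
  (∀ D → IndepDom G D → m ≤ count D)

module Submission where

-- Call the vertices of degree k simplicial. Every k-tree other than K_{k+1} carries a
-- proper colouring with k + 2 colours and, on each simplicial vertex v, a spare colour
-- absent from the closed neighbourhood of v, such that adjacent simplicial vertices get
-- different spares and every colour occurs on the closed neighbourhood of every vertex,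
-- counting the spare of a simplicial vertex as its own. For each colour c, the vertices
-- of colour c together with the simplicial vertices with spare c then form an independent
-- dominating set; these k + 2 sets have n + |V_k| elements in total, so the smallest has
-- at most (n + |V_k|)/(k + 2).
--
-- The structure also records, for every k-clique C, an apex w such that C ∪ {w} is a
-- (k+1)-clique, together with the one colour missing on C ∪ {w}. A vertex added on C
-- takes that colour, with the colour of w as its spare, and everything is preserved.
-- K_{k+1} itself is dominated by a single vertex. Equality holds for the k-th power of
-- the path on 2k + 2 vertices.

open import Defs hiding (sym)
import Data.Nat as ℕ
open import Data.Nat
  using (ℕ; zero; suc; _+_; _*_; ∣_-_∣; _≤_; _<_; z≤n; s≤s; _≡ᵇ_)
open import Data.Nat.Properties
  using ( ≤-refl; ≤-trans; ≤-reflexive; ≤-antisym; ≤-total; ≤-pred; <⇒≤; ≰⇒>; ≤∧≢⇒<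
        ; <-irrefl; 1+n≰n; suc-injective; n≤1+n; m≤n⇒m≤1+n; m≤m+n; m≤n+m
        ; +-suc; +-comm; +-mono-≤; +-monoˡ-≤; +-monoʳ-≤; +-cancelˡ-≤; *-identityʳ; *-monoʳ-≤
        ; ∣m-n∣≡[m∸n]∨[n∸m]; m≤n+o⇒m∸n≤o; m≤n+∣n-m∣; ∣-∣-comm; ∣n-n∣≡0; ∣-∣-identityʳ
        ; +-0-commutativeMonoid; module ≤-Reasoning)
open import Data.Nat.Tactic.RingSolver using (solve-∀)
open import Data.Bool using (Bool; true; false; not; _∧_; _∨_; if_then_else_)
open import Data.Bool.Properties using (¬-not; ∧-zeroʳ; ∧-identityʳ; ∨-zeroʳ)
open import Data.Fin using (Fin; zero; suc; _≟_; toℕ; fromℕ; fromℕ<; inject₁)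
open import Data.Fin.Properties
  using (fromℕ≢inject₁; inject₁-injective; toℕ-injective; toℕ≤pred[n]; toℕ-fromℕ; toℕ-fromℕ<)
import Data.Fin.Properties as Fin
open import Data.Fin.Relation.Unary.Top using (view; ‵fromℕ; ‵inject₁)
open import Data.Fin.Permutation using (Permutation′; _⟨$⟩ʳ_; _⟨$⟩ˡ_; inverseˡ; inverseʳ; flip)
import Data.Fin.Permutation as Perm
open import Data.Product using (Σ; _×_; _,_; proj₁; proj₂)
import Data.Product as Product
open import Data.Sum using (_⊎_; inj₁; inj₂)
import Data.Sum as Sum
open import Function using (_∘_)
open import Function.Bundles using (mk⇔)
open import Relation.Nullary using (¬_; Dec; yes; no; does; _×-dec_; _⊎-dec_)
open import Relation.Nullary.Decidable using (dec-true; dec-false; does-⇔)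
open import Relation.Nullary.Negation using (contradiction)
open import Relation.Binary.PropositionalEquality
  using (_≡_; _≢_; refl; sym; trans; cong; cong₂; subst; subst₂; module ≡-Reasoning)
open import Algebra.Properties.CommutativeMonoid.Sum +-0-commutativeMonoid
  using (sum; sum-cong-≗; ∑-permute; ∑-comm; ∑-distrib-+)

-- Counting

indicator : Bool → ℕ
indicator b = if b then 1 else 0

_⊆_ : ∀ {n} → (Fin n → Bool) → (Fin n → Bool) → Set
P ⊆ Q = ∀ i → P i ≡ true → Q i ≡ true

does-true : ∀ {A : Set} (a? : Dec A) → does a? ≡ true → A
does-true (yes a) _ = a

does-false : ∀ {A : Set} (a? : Dec A) → does a? ≡ false → ¬ A
does-false (no ¬a) _ = ¬a

count≡sum : ∀ {n} (P : Fin n → Bool) → count P ≡ sum (indicator ∘ P)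
count≡sum {zero}  P = refl
count≡sum {suc n} P = cong (indicator (P zero) +_) (count≡sum (P ∘ suc))

count-cong : ∀ {n} {P Q : Fin n → Bool} → (∀ i → P i ≡ Q i) → count P ≡ count Q
count-cong {P = P} {Q} P≗Q =
  trans (count≡sum P) (trans (sum-cong-≗ (cong indicator ∘ P≗Q)) (sym (count≡sum Q)))

count-permute : ∀ {n} (P : Fin n → Bool) (π : Permutation′ n) →
                count (λ i → P (π ⟨$⟩ʳ i)) ≡ count P
count-permute P π = trans (count≡sum (λ i → P (π ⟨$⟩ʳ i)))
                          (trans (sym (∑-permute (indicator ∘ P) π)) (sym (count≡sum P)))

count-false : ∀ n → count {n} (λ _ → false) ≡ 0
count-false zero    = refl
count-false (suc n) = count-false n

count-true : ∀ n → count {n} (λ _ → true) ≡ n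
count-true zero    = refl
count-true (suc n) = cong suc (count-true n)

count-≟ : ∀ {n} (x : Fin n) → count (λ c → does (x ≟ c)) ≡ 1
count-≟ {suc n} zero    = cong suc (count-false n)
count-≟         (suc x) = count-≟ x

count-not : ∀ {n} (P : Fin n → Bool) → count P + count (not ∘ P) ≡ n
count-not {zero}  P = refl
count-not {suc n} P with P zero
... | true  = cong suc (count-not (P ∘ suc))
... | false = trans (+-suc (count (P ∘ suc)) _) (cong suc (count-not (P ∘ suc)))

indicator-mono : ∀ {a b} → (a ≡ true → b ≡ true) → indicator a ≤ indicator b
indicator-mono {false}     _   = z≤n
indicator-mono {true}  a⇒b rewrite a⇒b refl = ≤-refl

count-mono : ∀ {n} {P Q : Fin n → Bool} → P ⊆ Q → count P ≤ count Q
count-mono {zero}  P⊆Q = z≤n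
count-mono {suc n} P⊆Q = +-mono-≤ (indicator-mono (P⊆Q zero)) (count-mono (P⊆Q ∘ suc))

count-mono-< : ∀ {n} {P Q : Fin n → Bool} → P ⊆ Q →
               ∀ i → Q i ≡ true → P i ≡ false → count P < count Q
count-mono-< P⊆Q zero Qi Pi rewrite Qi | Pi = s≤s (count-mono (P⊆Q ∘ suc))
count-mono-< {P = P} P⊆Q (suc i) Qi Pi =
  ≤-trans (≤-reflexive (sym (+-suc (indicator (P zero)) _)))
          (+-mono-≤ (indicator-mono (P⊆Q zero)) (count-mono-< (P⊆Q ∘ suc) i Qi Pi))

count-∨ : ∀ {n} (P Q : Fin n → Bool) → count (λ i → P i ∨ Q i) ≤ count P + count Q
count-∨ {zero}  P Q = z≤n
count-∨ {suc n} P Q with P zero | Q zero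
... | true  | true  = s≤s (≤-trans (count-∨ (P ∘ suc) (Q ∘ suc))
                                  (≤-trans (n≤1+n _) (≤-reflexive (sym (+-suc _ _)))))
... | true  | false = s≤s (count-∨ (P ∘ suc) (Q ∘ suc))
... | false | true  = ≤-trans (s≤s (count-∨ (P ∘ suc) (Q ∘ suc))) (≤-reflexive (sym (+-suc _ _)))
... | false | false = count-∨ (P ∘ suc) (Q ∘ suc)

unique-difference : ∀ {n} {P Q : Fin n → Bool} → P ⊆ Q → count Q ≡ suc (count P) →
                    Σ (Fin n) λ w → Q w ≡ true × P w ≡ false ×
                      (∀ u → Q u ≡ true → P u ≡ false → u ≡ w)
unique-difference {suc n} {P} {Q} P⊆Q #Q with P zero in P0 | Q zero in Q0
... | true  | false = contradiction (trans (sym (P⊆Q zero P0)) Q0) λ ()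
... | false | false with unique-difference (P⊆Q ∘ suc) #Q
...   | w , Qw , Pw , unique = suc w , Qw , Pw , λ
  { zero    Qu _  → contradiction (trans (sym Q0) Qu) λ ()
  ; (suc u) Qu Pu → cong suc (unique u Qu Pu) }
unique-difference {suc n} {P} {Q} P⊆Q #Q | true | true
  with unique-difference (P⊆Q ∘ suc) (suc-injective #Q)
...   | w , Qw , Pw , unique = suc w , Qw , Pw , λ
  { zero    _  Pu → contradiction (trans (sym P0) Pu) λ ()
  ; (suc u) Qu Pu → cong suc (unique u Qu Pu) }
unique-difference {suc n} {P} {Q} P⊆Q #Q | false | true = zero , Q0 , P0 , λ
  { zero    _  _  → refl
  ; (suc u) Qu Pu → contradiction (suc-injective #Q)
                      (λ eq → <-irrefl (sym eq) (count-mono-< (P⊆Q ∘ suc) u Qu Pu)) }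

count-≥2 : ∀ {n} (D : Fin n → Bool) a b → D a ≡ true → D b ≡ true → a ≢ b → 2 ≤ count D
count-≥2 D a b Da Db a≢b =
  subst (_< count D) (count-≟ a) (count-mono-< a⊆D b Db (dec-false (a ≟ b) a≢b))
  where
  a⊆D : (λ c → does (a ≟ c)) ⊆ D
  a⊆D c a≡c with does-true (a ≟ c) a≡c
  ... | refl = Da

pair : ∀ {n} → Fin n → Fin n → Fin n → Bool
pair a b v = does (a ≟ v) ∨ does (b ≟ v)

count-pair : ∀ {n} (a b : Fin n) → count (pair a b) ≤ 2
count-pair a b = ≤-trans (count-∨ (λ v → does (a ≟ v)) (λ v → does (b ≟ v)))
                         (≤-reflexive (cong₂ _+_ (count-≟ a) (count-≟ b)))

pair-∋ˡ : ∀ {n} (a b : Fin n) → pair a b a ≡ true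
pair-∋ˡ a b = cong (_∨ does (b ≟ a)) (dec-true (a ≟ a) refl)

pair-∋ʳ : ∀ {n} (a b : Fin n) → pair a b b ≡ true
pair-∋ʳ a b = trans (cong (does (a ≟ b) ∨_) (dec-true (b ≟ b) refl)) (∨-zeroʳ (does (a ≟ b)))

pair-elements : ∀ {n} (a b v : Fin n) → pair a b v ≡ true → a ≡ v ⊎ b ≡ v
pair-elements a b v abv with a ≟ v | b ≟ v
... | yes a≡v | _       = inj₁ a≡v
... | no _    | yes b≡v = inj₂ b≡v

sum-mono : ∀ {n} {f g : Fin n → ℕ} → (∀ i → f i ≤ g i) → sum f ≤ sum g
sum-mono {zero}  f≤g = z≤n
sum-mono {suc n} f≤g = +-mono-≤ (f≤g zero) (sum-mono (f≤g ∘ suc))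

sum-count : ∀ {m n} (P : Fin m → Fin n → Bool) →
            sum (λ c → count (P c)) ≡ sum (λ v → count (λ c → P c v))
sum-count P = begin
  sum (λ c → count (P c))                    ≡⟨ sum-cong-≗ (λ c → count≡sum (P c)) ⟩
  sum (λ c → sum (λ v → indicator (P c v)))  ≡⟨ ∑-comm (λ c v → indicator (P c v)) ⟩
  sum (λ v → sum (λ c → indicator (P c v)))
    ≡⟨ sum-cong-≗ (λ v → sym (count≡sum (λ c → P c v))) ⟩
  sum (λ v → count (λ c → P c v))            ∎
  where open ≡-Reasoning

∃-≤-average : ∀ {N} (f : Fin (suc N) → ℕ) → Σ (Fin (suc N)) λ c → suc N * f c ≤ sum f
∃-≤-average {zero}  f = zero , ≤-refl
∃-≤-average {suc N} f with ∃-≤-average (f ∘ suc)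
... | c , h with ≤-total (f zero) (f (suc c))
...   | inj₁ f0≤fc = zero , +-monoʳ-≤ (f zero) (≤-trans (*-monoʳ-≤ (suc N) f0≤fc) h)
...   | inj₂ fc≤f0 = suc c , +-mono-≤ fc≤f0 h

-- Colourings with apexes, and spare colours

Colour : ℕ → Set
Colour k = Fin (2 + k)

record Apex {n k} (G : Graph n) (colour : Fin n → Colour k) (C : Fin n → Bool) : Set where
  field
    apex      : Fin n
    apex∉C    : C apex ≡ false
    apex-adj  : ∀ u → C u ≡ true → adj G apex u ≡ true
    free      : Colour k
    free≢apex : free ≢ colour apex
    free∉C    : ∀ u → C u ≡ true → free ≢ colour u
    cover     : ∀ c → c ≡ colour apex ⊎ c ≡ free ⊎ Σ (Fin n) λ u → C u ≡ true × colour u ≡ c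

record Colouring {n} (k : ℕ) (G : Graph n) : Set where
  field
    colour : Fin n → Colour k
    proper : ∀ u v → adj G u v ≡ true → colour u ≢ colour v
    apexOf : ∀ C → IsClique G k C → Apex G colour C

record Scheme {n} (k : ℕ) (G : Graph n) : Set where
  field
    colouring : Colouring k G
  open Colouring colouring public
  field
    spare     : Fin n → Colour k
    covered   : ∀ v c → colour v ≡ c ⊎ (deg G v ≡ k × spare v ≡ c) ⊎
                        Σ (Fin n) λ u → adj G v u ≡ true × colour u ≡ c
    spare≢own : ∀ v → deg G v ≡ k → spare v ≢ colour v
    spare≢nbr : ∀ v u → deg G v ≡ k → adj G v u ≡ true → spare v ≢ colour u

module _ {n k} {G : Graph n} (s : Scheme k G) where
  open Scheme s

  SparesSeparated : Set
  SparesSeparated = ∀ u v → adj G u v ≡ true → deg G u ≡ k → deg G v ≡ k → spare u ≢ spare v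

  SparesSeparatedOff : (Fin n → Bool) → Set
  SparesSeparatedOff C = ∀ u v → C u ≡ false → C v ≡ false → adj G u v ≡ true →
                         deg G u ≡ k → deg G v ≡ k → spare u ≢ spare v

IndepDomBound : ∀ {n} → ℕ → Graph n → Set
IndepDomBound {n} k G = Σ (Fin n → Bool) λ D → IndepDom G D × (2 + k) * count D ≤ n + numDeg G k

module Classes {n k} {G : Graph n} (s : Scheme k G) (separated : SparesSeparated s) where
  open Scheme s

  InClass : Colour k → Fin n → Set
  InClass c v = (deg G v ≡ k × spare v ≡ c) ⊎ colour v ≡ c

  inClass? : ∀ c v → Dec (InClass c v)
  inClass? c v = (deg G v ℕ.≟ k ×-dec spare v ≟ c) ⊎-dec colour v ≟ c

  class : Colour k → Fin n → Bool
  class c v = does (inClass? c v)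

  nonadjacent-in-class : ∀ {c u v} → InClass c u → InClass c v → adj G u v ≢ true
  nonadjacent-in-class (inj₂ cu) (inj₂ cv) uv = proper _ _ uv (trans cu (sym cv))
  nonadjacent-in-class (inj₂ cu) (inj₁ (dv , sv)) uv =
    spare≢nbr _ _ dv (trans (Graph.sym G _ _) uv) (trans sv (sym cu))
  nonadjacent-in-class (inj₁ (du , su)) (inj₂ cv) uv = spare≢nbr _ _ du uv (trans su (sym cv))
  nonadjacent-in-class (inj₁ (du , su)) (inj₁ (dv , sv)) uv =
    separated _ _ uv du dv (trans su (sym sv))

  class-independent : ∀ c → Independent G (class c)
  class-independent c u v cu cv =
    ¬-not (nonadjacent-in-class (does-true (inClass? c u) cu) (does-true (inClass? c v) cv))

  class-dominating : ∀ c → Dominating G (class c)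
  class-dominating c v cv with covered v c
  ... | inj₁ own                  = contradiction (inj₂ own) (does-false (inClass? c v) cv)
  ... | inj₂ (inj₁ spare≡c)       = contradiction (inj₁ spare≡c) (does-false (inClass? c v) cv)
  ... | inj₂ (inj₂ (u , vu , cu)) =
    u , dec-true (inClass? c u) (inj₂ cu) , trans (Graph.sym G u v) vu

  classes-of-vertex : ∀ v → count (λ c → class c v) ≤ indicator (deg G v ≡ᵇ k) + 1
  classes-of-vertex v = ≤-trans
    (count-∨ (λ c → (deg G v ≡ᵇ k) ∧ does (spare v ≟ c)) (λ c → does (colour v ≟ c)))
    (+-mono-≤ (spare-classes (deg G v ≡ᵇ k)) (≤-reflexive (count-≟ (colour v))))
    where
    spare-classes : ∀ b → count (λ c → b ∧ does (spare v ≟ c)) ≤ indicator b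
    spare-classes false = ≤-reflexive (count-false (2 + k))
    spare-classes true  = ≤-reflexive (count-≟ (spare v))

  classes-total : sum (λ c → count (class c)) ≤ n + numDeg G k
  classes-total = begin
    sum (λ c → count (class c))                ≡⟨ sum-count class ⟩
    sum (λ v → count (λ c → class c v))        ≤⟨ sum-mono classes-of-vertex ⟩
    sum (λ v → indicator (deg G v ≡ᵇ k) + 1)
      ≡⟨ ∑-distrib-+ (λ v → indicator (deg G v ≡ᵇ k)) (λ _ → 1) ⟩
    sum (λ v → indicator (deg G v ≡ᵇ k)) + sum (λ (_ : Fin n) → 1)
      ≡⟨ cong₂ _+_ (sym (count≡sum (λ v → deg G v ≡ᵇ k)))
                   (trans (sym (count≡sum {n} (λ _ → true))) (count-true n)) ⟩
    numDeg G k + n                              ≡⟨ +-comm (numDeg G k) n ⟩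
    n + numDeg G k                              ∎
    where open ≤-Reasoning

  bound : IndepDomBound k G
  bound with ∃-≤-average (λ c → count (class c))
  ... | c , average = class c , (class-independent c , class-dominating c) , ≤-trans average classes-total

-- Complete graphs

IsComplete : ∀ {n} → Graph n → Set
IsComplete {n} G = ∀ (u v : Fin n) → u ≢ v → adj G u v ≡ true

record Complete {n} (k : ℕ) (G : Graph n) : Set where
  field
    order      : n ≡ suc k
    isComplete : IsComplete G

complete-isComplete : ∀ m → IsComplete (complete m)
complete-isComplete m u v u≢v = cong not (dec-false (u ≟ v) u≢v)

adjacent⇒≢ : ∀ {n} (G : Graph n) {u v} → adj G u v ≡ true → u ≢ v
adjacent⇒≢ G {u} uv refl = contradiction (trans (sym (irrefl G u)) uv) λ ()

clique-complement : ∀ {k} {G : Graph (suc k)} {C} → IsClique G k C →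
                    Σ (Fin (suc k)) λ w → C w ≡ false × (∀ u → C u ≡ false → u ≡ w)
clique-complement {k} {C = C} (#C , _)
  with unique-difference {P = C} {Q = λ _ → true} (λ _ _ → refl)
                         (trans (count-true (suc k)) (cong suc (sym #C)))
... | w , _ , Cw , unique = w , Cw , λ u → unique u refl

clique-separatedOff : ∀ {k} {G : Graph (suc k)} (s : Scheme k G) {C} → IsClique G k C →
                      SparesSeparatedOff s C
clique-separatedOff {G = G} s C-clique u v Cu Cv uv _ _ _ with clique-complement {G = G} C-clique
... | w , _ , unique = adjacent⇒≢ G uv (trans (unique u Cu) (sym (unique v Cv)))

module _ {k} {G : Graph (suc k)} (complete : IsComplete G) where

  complete-deg : ∀ v → deg G v ≡ k
  complete-deg v = suc-injective (begin
    suc (deg G v)                    ≡⟨ cong suc (count-cong adj≡≢) ⟩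
    suc (count (not ∘ is-v))         ≡⟨ cong (_+ count (not ∘ is-v)) (sym (count-≟ v)) ⟩
    count is-v + count (not ∘ is-v)  ≡⟨ count-not is-v ⟩
    suc k                            ∎)
    where
    open ≡-Reasoning
    is-v : Fin (suc k) → Bool
    is-v u = does (v ≟ u)
    adj≡≢ : ∀ u → adj G v u ≡ not (is-v u)
    adj≡≢ u with v ≟ u
    ... | yes refl = irrefl G v
    ... | no v≢u   = complete v u v≢u

  complete-bound : IndepDomBound k G
  complete-bound = D , (independent , dominating) , bound
    where
    D : Fin (suc k) → Bool
    D v = does (zero ≟ v)
    independent : Independent G D
    independent u v Du Dv with does-true (zero ≟ u) Du | does-true (zero ≟ v) Dv
    ... | refl | refl = irrefl G zero
    dominating : Dominating G D
    dominating v Dv = zero , refl , complete zero v (does-false (zero ≟ v) Dv)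
    all-simplicial : numDeg G k ≡ suc k
    all-simplicial = trans (count-cong (λ v → dec-true (deg G v ℕ.≟ k) (complete-deg v)))
                           (count-true (suc k))
    bound : (2 + k) * count D ≤ suc k + numDeg G k
    bound = begin
      (2 + k) * count D   ≡⟨ cong ((2 + k) *_) (count-≟ {suc k} zero) ⟩
      (2 + k) * 1         ≡⟨ *-identityʳ (2 + k) ⟩
      2 + k               ≤⟨ s≤s (m≤n+m (suc k) k) ⟩
      suc k + suc k       ≡⟨ cong (suc k +_) (sym all-simplicial) ⟩
      suc k + numDeg G k  ∎
      where open ≤-Reasoning

  complete-apex : ∀ C → IsClique G k C → Apex G inject₁ C
  complete-apex C C-clique with clique-complement {G = G} C-clique
  ... | w , Cw , unique = record
    { apex      = w
    ; apex∉C    = Cw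
    ; apex-adj  = λ u Cu → complete w u λ { refl → contradiction (trans (sym Cw) Cu) λ () }
    ; free      = fromℕ (suc k)
    ; free≢apex = fromℕ≢inject₁
    ; free∉C    = λ _ _ → fromℕ≢inject₁
    ; cover     = cover
    }
    where
    cover : ∀ c → c ≡ inject₁ w ⊎ c ≡ fromℕ (suc k) ⊎
                  Σ (Fin (suc k)) λ u → C u ≡ true × inject₁ u ≡ c
    cover c with view c
    ... | ‵fromℕ     = inj₂ (inj₁ refl)
    ... | ‵inject₁ x with x ≟ w | C x in Cx
    ...   | yes refl | _     = inj₁ refl
    ...   | no _     | true  = inj₂ (inj₂ (x , Cx , refl))
    ...   | no x≢w   | false = contradiction (unique x Cx) x≢w

  complete-scheme : Scheme k G
  complete-scheme = record
    { colouring = record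
      { colour = inject₁
      ; proper = λ u v uv eq → adjacent⇒≢ G uv (inject₁-injective eq)
      ; apexOf = complete-apex
      }
    ; spare     = λ _ → fromℕ (suc k)
    ; covered   = covered
    ; spare≢own = λ _ _ → fromℕ≢inject₁
    ; spare≢nbr = λ _ _ _ _ → fromℕ≢inject₁
    }
    where
    covered : ∀ v c → inject₁ v ≡ c ⊎ (deg G v ≡ k × fromℕ (suc k) ≡ c) ⊎
                      Σ (Fin (suc k)) λ u → adj G v u ≡ true × inject₁ u ≡ c
    covered v c with view c
    ... | ‵fromℕ     = inj₂ (inj₁ (complete-deg v , refl))
    ... | ‵inject₁ x with v ≟ x
    ...   | yes refl = inj₁ refl
    ...   | no v≢x   = inj₂ (inj₂ (x , complete v x v≢x , refl))

-- Adding a vertex on a k-clique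

MinDegree : ∀ {n} → ℕ → Graph n → Set
MinDegree {n} k G = ∀ (v : Fin n) → k ≤ deg G v

extend-minDegree : ∀ {n k} {G : Graph n} {C} → MinDegree k G → IsClique G k C →
                   MinDegree k (extend G C)
extend-minDegree minDeg (#C , _) zero    = ≤-reflexive (sym #C)
extend-minDegree minDeg _        (suc v) = ≤-trans (minDeg v) (m≤n+m _ _)

extend-simplicial : ∀ {n k} {G : Graph n} {C} → MinDegree k G →
                    ∀ u → deg (extend G C) (suc u) ≡ k → C u ≡ false × deg G u ≡ k
extend-simplicial {G = G} {C} minDeg u d with C u
... | false = refl , d
... | true  = contradiction (minDeg u) (subst (λ m → ¬ m ≤ deg G u) d 1+n≰n)

module Extend {n k} {G : Graph n} (κ : Colouring k G)
              (C : Fin n → Bool) (C-clique : IsClique G k C) where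
  open Colouring κ
  open Apex (apexOf C C-clique)

  G⁺ : Graph (suc n)
  G⁺ = extend G C

  colour⁺ : Fin (suc n) → Colour k
  colour⁺ zero    = free
  colour⁺ (suc u) = colour u

  proper⁺ : ∀ u v → adj G⁺ u v ≡ true → colour⁺ u ≢ colour⁺ v
  proper⁺ zero    (suc v) Cv = free∉C v Cv
  proper⁺ (suc u) zero    Cu = free∉C u Cu ∘ sym
  proper⁺ (suc u) (suc v) uv = proper u v uv

  apex-avoiding-new : ∀ C′ → C′ zero ≡ false → IsClique G⁺ k C′ → Apex G⁺ colour⁺ C′
  apex-avoiding-new C′ C′0 (#C′ , C′-adj) = record
    { apex      = suc apex′
    ; apex∉C    = apex∉C′
    ; apex-adj  = λ { zero C′0≡true → contradiction (trans (sym C′0) C′0≡true) λ ()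
                    ; (suc u) → apex-adj′ u }
    ; free      = free′
    ; free≢apex = free≢apex′
    ; free∉C    = λ { zero C′0≡true → contradiction (trans (sym C′0) C′0≡true) λ ()
                    ; (suc u) → free∉C′ u }
    ; cover     = Sum.map₂ (Sum.map₂ λ { (u , C′u , cu) → suc u , C′u , cu }) ∘ cover′
    }
    where
    old-clique : IsClique G k (C′ ∘ suc)
    old-clique = trans (cong (λ b → indicator b + count (C′ ∘ suc)) (sym C′0)) #C′
               , λ u v C′u C′v u≢v → C′-adj (suc u) (suc v) C′u C′v (u≢v ∘ Fin.suc-injective)
    open Apex (apexOf (C′ ∘ suc) old-clique) renaming
      ( apex to apex′ ; apex∉C to apex∉C′ ; apex-adj to apex-adj′ ; free to free′
      ; free≢apex to free≢apex′ ; free∉C to free∉C′ ; cover to cover′ )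

  through-new⊆C : ∀ C′ → C′ zero ≡ true → IsClique G⁺ k C′ → (C′ ∘ suc) ⊆ C
  through-new⊆C C′ C′0 (_ , C′-adj) u C′u = C′-adj zero (suc u) C′0 C′u λ ()

  -- A k-clique through the new vertex consists of it and all of C but one vertex u₁;
  -- its apex is u₁, and the colour it misses is that of the apex of C.
  apex-through-new : ∀ C′ → C′ zero ≡ true → IsClique G⁺ k C′ → Apex G⁺ colour⁺ C′
  apex-through-new C′ C′0 C′-clique@(#C′ , _)
    with unique-difference (through-new⊆C C′ C′0 C′-clique)
           (trans (proj₁ C-clique)
                  (trans (sym #C′) (cong (λ b → indicator b + count (C′ ∘ suc)) C′0)))
  ... | u₁ , Cu₁ , C′u₁ , unique = record
    { apex      = suc u₁
    ; apex∉C    = C′u₁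
    ; apex-adj  = λ { zero _ → Cu₁
                    ; (suc x) C′x → proj₂ C-clique u₁ x Cu₁ (C′⊆C x C′x)
                                      λ { refl → contradiction (trans (sym C′u₁) C′x) λ () } }
    ; free      = colour apex
    ; free≢apex = proper apex u₁ (apex-adj u₁ Cu₁)
    ; free∉C    = λ { zero _ → free≢apex ∘ sym
                    ; (suc x) C′x → proper apex x (apex-adj x (C′⊆C x C′x)) }
    ; cover     = cover⁺
    }
    where
    C′⊆C : (C′ ∘ suc) ⊆ C
    C′⊆C = through-new⊆C C′ C′0 C′-clique
    cover⁺ : ∀ c → c ≡ colour u₁ ⊎ c ≡ colour apex ⊎
                   Σ (Fin (suc n)) λ u → C′ u ≡ true × colour⁺ u ≡ c
    cover⁺ c with cover c
    ... | inj₁ c≡apex               = inj₂ (inj₁ c≡apex)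
    ... | inj₂ (inj₁ c≡free)        = inj₂ (inj₂ (zero , C′0 , sym c≡free))
    ... | inj₂ (inj₂ (u , Cu , cu)) with u ≟ u₁ | C′ (suc u) in C′u
    ...   | yes refl | _     = inj₁ (sym cu)
    ...   | no _     | true  = inj₂ (inj₂ (suc u , C′u , cu))
    ...   | no u≢u₁  | false = contradiction (unique u Cu C′u) u≢u₁

  apexOf⁺ : ∀ C′ → IsClique G⁺ k C′ → Apex G⁺ colour⁺ C′
  apexOf⁺ C′ = through-new? (C′ zero) refl
    where
    -- A with on C′ zero would also rewrite the unfolded count in the clique hypothesis.
    through-new? : ∀ b → C′ zero ≡ b → IsClique G⁺ k C′ → Apex G⁺ colour⁺ C′
    through-new? false = apex-avoiding-new C′
    through-new? true  = apex-through-new C′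

  colouring⁺ : Colouring k G⁺
  colouring⁺ = record { colour = colour⁺ ; proper = proper⁺ ; apexOf = apexOf⁺ }

module ExtendScheme {n k} {G : Graph n} (s : Scheme k G) (minDeg : MinDegree k G)
                    (C : Fin n → Bool) (C-clique : IsClique G k C) where
  open Scheme s
  open Extend colouring C C-clique
  open Apex (apexOf C C-clique)

  spare⁺ : Fin (suc n) → Colour k
  spare⁺ zero    = colour apex
  spare⁺ (suc u) = spare u

  old-simplicial : ∀ u → deg G⁺ (suc u) ≡ k → C u ≡ false × deg G u ≡ k
  old-simplicial = extend-simplicial {G = G} {C} minDeg

  clique-not-simplicial : ∀ v → C v ≡ true → deg G⁺ (suc v) ≢ k
  clique-not-simplicial v Cv d = contradiction (trans (sym Cv) (proj₁ (old-simplicial v d))) λ ()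

  -- A vertex of C stops being simplicial; its spare can only have been the free colour
  -- of C, which the new vertex now carries.
  covered⁺ : ∀ v c → colour⁺ v ≡ c ⊎ (deg G⁺ v ≡ k × spare⁺ v ≡ c) ⊎
                     Σ (Fin (suc n)) λ u → adj G⁺ v u ≡ true × colour⁺ u ≡ c
  covered⁺ zero c with cover c
  ... | inj₁ c≡apex               = inj₂ (inj₁ (proj₁ C-clique , sym c≡apex))
  ... | inj₂ (inj₁ c≡free)        = inj₁ (sym c≡free)
  ... | inj₂ (inj₂ (u , Cu , cu)) = inj₂ (inj₂ (suc u , Cu , cu))
  covered⁺ (suc v) c with covered v c
  ... | inj₁ own                  = inj₁ own
  ... | inj₂ (inj₂ (u , vu , cu)) = inj₂ (inj₂ (suc u , vu , cu))
  ... | inj₂ (inj₁ (d , sv)) with C v in Cv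
  ...   | false = inj₂ (inj₁ (d , sv))
  ...   | true with cover c
  ...     | inj₂ (inj₁ c≡free) = inj₂ (inj₂ (zero , Cv , sym c≡free))
  ...     | inj₁ c≡apex =
    contradiction (trans sv c≡apex) (spare≢nbr v apex d (trans (Graph.sym G v apex) (apex-adj v Cv)))
  ...     | inj₂ (inj₂ (u , Cu , cu)) with v ≟ u
  ...       | yes refl = contradiction (trans sv (sym cu)) (spare≢own v d)
  ...       | no v≢u   =
    contradiction (trans sv (sym cu)) (spare≢nbr v u d (proj₂ C-clique v u Cv Cu v≢u))

  spare≢own⁺ : ∀ v → deg G⁺ v ≡ k → spare⁺ v ≢ colour⁺ v
  spare≢own⁺ zero    _ = free≢apex ∘ sym
  spare≢own⁺ (suc v) d = spare≢own v (proj₂ (old-simplicial v d))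

  spare≢nbr⁺ : ∀ v u → deg G⁺ v ≡ k → adj G⁺ v u ≡ true → spare⁺ v ≢ colour⁺ u
  spare≢nbr⁺ zero    (suc u) _ Cu = proper apex u (apex-adj u Cu)
  spare≢nbr⁺ (suc v) zero    d Cv = contradiction d (clique-not-simplicial v Cv)
  spare≢nbr⁺ (suc v) (suc u) d vu = spare≢nbr v u (proj₂ (old-simplicial v d)) vu

  scheme⁺ : Scheme k G⁺
  scheme⁺ = record
    { colouring = colouring⁺
    ; spare     = spare⁺
    ; covered   = covered⁺
    ; spare≢own = spare≢own⁺
    ; spare≢nbr = spare≢nbr⁺
    }

  separated⁺ : SparesSeparatedOff s C → SparesSeparated scheme⁺
  separated⁺ sep zero    (suc v) Cv _  dv = contradiction dv (clique-not-simplicial v Cv)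
  separated⁺ sep (suc u) zero    Cu du _  = contradiction du (clique-not-simplicial u Cu)
  separated⁺ sep (suc u) (suc v) uv du dv with old-simplicial u du | old-simplicial v dv
  ... | Cu , du′ | Cv , dv′ = sep u v Cu Cv uv du′ dv′

-- Relabelling vertices

module Relabel {n} {G H : Graph n} (π : Permutation′ n)
               (H≅G : ∀ u v → adj H u v ≡ adj G (π ⟨$⟩ʳ u) (π ⟨$⟩ʳ v)) where

  p q : Fin n → Fin n
  p i = π ⟨$⟩ʳ i
  q i = π ⟨$⟩ˡ i

  p∘q : ∀ i → p (q i) ≡ i
  p∘q i = inverseʳ π

  q∘p : ∀ i → q (p i) ≡ i
  q∘p i = inverseˡ π

  p-injective : ∀ {u v} → p u ≡ p v → u ≡ v
  p-injective {u} {v} e = trans (sym (q∘p u)) (trans (cong q e) (q∘p v))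

  q-injective : ∀ {u v} → q u ≡ q v → u ≡ v
  q-injective {u} {v} e = trans (sym (p∘q u)) (trans (cong p e) (p∘q v))

  H⇒G : ∀ {u v} → adj H u v ≡ true → adj G (p u) (p v) ≡ true
  H⇒G {u} {v} = trans (sym (H≅G u v))

  G⇒H : ∀ {u v} → adj G (p u) (p v) ≡ true → adj H u v ≡ true
  G⇒H {u} {v} = trans (H≅G u v)

  G⇒H-q : ∀ {u v} → adj G (p u) v ≡ true → adj H u (q v) ≡ true
  G⇒H-q {u} {v} = G⇒H ∘ subst (λ x → adj G (p u) x ≡ true) (sym (p∘q v))

  deg-relabel : ∀ u → deg H u ≡ deg G (p u)
  deg-relabel u = trans (count-cong (H≅G u)) (count-permute (adj G (p u)) π)

  clique-relabel : ∀ {k C} → IsClique H k C → IsClique G k (C ∘ q)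
  clique-relabel {C = C} (#C , C-adj) =
      trans (count-permute C (flip π)) #C
    , λ u v Cu Cv u≢v → subst₂ (λ x y → adj G x y ≡ true) (p∘q u) (p∘q v)
                          (H⇒G (C-adj (q u) (q v) Cu Cv (u≢v ∘ q-injective)))

  minDegree-relabel : ∀ {k} → MinDegree k G → MinDegree k H
  minDegree-relabel minDeg v = subst (_ ≤_) (sym (deg-relabel v)) (minDeg (p v))

  complete-relabel : ∀ {k} → Complete k G → Complete k H
  complete-relabel K = record
    { order      = Complete.order K
    ; isComplete = λ u v u≢v → G⇒H (Complete.isComplete K (p u) (p v) (u≢v ∘ p-injective))
    }

  colouring-relabel : ∀ {k} → Colouring k G → Colouring k H
  colouring-relabel κ = record
    { colour = colour ∘ p
    ; proper = λ u v uv → proper (p u) (p v) (H⇒G uv)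
    ; apexOf = apex-relabel
    }
    where
    open Colouring κ
    apex-relabel : ∀ C → IsClique H _ C → Apex H (colour ∘ p) C
    apex-relabel C C-clique = record
      { apex      = q apex
      ; apex∉C    = apex∉C
      ; apex-adj  = λ u Cu → trans (Graph.sym H _ _) (G⇒H-q (trans (Graph.sym G _ _)
                                (apex-adj (p u) (trans (cong C (q∘p u)) Cu))))
      ; free      = free
      ; free≢apex = free≢apex ∘ λ e → trans e (cong colour (p∘q apex))
      ; free∉C    = λ u Cu → free∉C (p u) (trans (cong C (q∘p u)) Cu)
      ; cover     = Sum.map (λ e → trans e (cong colour (sym (p∘q apex))))
                            (Sum.map₂ λ { (u , Cu , cu) → q u , Cu , trans (cong colour (p∘q u)) cu })
                    ∘ cover
      }
      where open Apex (apexOf (C ∘ q) (clique-relabel C-clique))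

  scheme-relabel : ∀ {k} → Scheme k G → Scheme k H
  scheme-relabel {k} s = record
    { colouring = colouring-relabel colouring
    ; spare     = spare ∘ p
    ; covered   = covered′
    ; spare≢own = λ v d → spare≢own (p v) (trans (sym (deg-relabel v)) d)
    ; spare≢nbr = λ v u d vu → spare≢nbr (p v) (p u) (trans (sym (deg-relabel v)) d) (H⇒G vu)
    }
    where
    open Scheme s
    covered′ : ∀ v c → colour (p v) ≡ c ⊎ (deg H v ≡ k × spare (p v) ≡ c) ⊎
                       Σ (Fin n) λ u → adj H v u ≡ true × colour (p u) ≡ c
    covered′ v c with covered (p v) c
    ... | inj₁ own                  = inj₁ own
    ... | inj₂ (inj₁ (d , sv))      = inj₂ (inj₁ (trans (deg-relabel v) d , sv))
    ... | inj₂ (inj₂ (u , vu , cu)) = inj₂ (inj₂ (q u , G⇒H-q vu , trans (cong colour (p∘q u)) cu))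

  separated-relabel : ∀ {k} (s : Scheme k G) → SparesSeparated s → SparesSeparated (scheme-relabel s)
  separated-relabel s sep u v uv du dv =
    sep (p u) (p v) (H⇒G uv) (trans (sym (deg-relabel u)) du) (trans (sym (deg-relabel v)) dv)

-- k-trees

ktree-minDegree : ∀ {k n} {G : Graph n} → KTree k G → MinDegree k G
ktree-minDegree {k} base =
  ≤-reflexive ∘ sym ∘ complete-deg {G = complete (suc k)} (complete-isComplete (suc k))
ktree-minDegree (step _ T C-clique) = extend-minDegree (ktree-minDegree T) C-clique
ktree-minDegree (iso {G = G} {H} π T H≅G) =
  Relabel.minDegree-relabel {G = G} {H} π H≅G (ktree-minDegree T)

-- In K_{k+1} the spares cannot be separated: each spare must be the one colour missing
-- from the whole graph. One step later they can, as only one vertex lies off the clique.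
ktree-scheme : ∀ {k n} {G : Graph n} → KTree k G →
               Σ (Scheme k G) λ s → Complete k G ⊎ SparesSeparated s
ktree-scheme {k} base = complete-scheme K , inj₁ (record { order = refl ; isComplete = K })
  where
  K : IsComplete (complete (suc k))
  K = complete-isComplete (suc k)
ktree-scheme (step {G = G} C T C-clique) with ktree-scheme T
... | s , separated = scheme⁺ , inj₂ (separated⁺ (separatedOff separated))
  where
  open ExtendScheme s (ktree-minDegree T) C C-clique
  separatedOff : Complete _ G ⊎ SparesSeparated s → SparesSeparatedOff s C
  separatedOff (inj₁ record { order = refl }) = clique-separatedOff s C-clique
  separatedOff (inj₂ sep) u v _ _             = sep u v
ktree-scheme (iso {G = G} {H} π T H≅G) with ktree-scheme T
... | s , complete-or-separated =
  scheme-relabel s , Sum.map complete-relabel (separated-relabel s) complete-or-separated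
  where open Relabel {G = G} {H} π H≅G

ktree-bound : ∀ {k n} {G : Graph n} → KTree k G → IndepDomBound k G
ktree-bound {G = G} T with ktree-scheme T
... | s , inj₁ record { order = refl ; isComplete = K } = complete-bound {G = G} K
... | s , inj₂ separated                               = Classes.bound s separated

indepDom-upper-bound : (k n : ℕ) (G : Graph n) → KTree k G → (m : ℕ) →
                       IsIndepDomNumber G m → (k + 2) * m ≤ n + numDeg G k
indepDom-upper-bound k n G T m (_ , minimal) with ktree-bound T
... | D , D-indepDom , bound = begin
  (k + 2) * m        ≡⟨ cong (_* m) (+-comm k 2) ⟩
  (2 + k) * m        ≤⟨ *-monoʳ-≤ (2 + k) (minimal D D-indepDom) ⟩
  (2 + k) * count D  ≤⟨ bound ⟩
  n + numDeg G k     ∎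
  where open ≤-Reasoning

-- Powers of paths

∣m-n∣≤o : ∀ {m n o} → m ≤ n + o → n ≤ m + o → ∣ m - n ∣ ≤ o
∣m-n∣≤o {m} {n} m≤n+o n≤m+o with ∣m-n∣≡[m∸n]∨[n∸m] m n
... | inj₁ eq = subst (_≤ _) (sym eq) (m≤n+o⇒m∸n≤o m n m≤n+o)
... | inj₂ eq = subst (_≤ _) (sym eq) (m≤n+o⇒m∸n≤o n m n≤m+o)

∣m-n∣≤o⇒n≤m+o : ∀ {m n o} → ∣ m - n ∣ ≤ o → n ≤ m + o
∣m-n∣≤o⇒n≤m+o {m} {n} d≤o = ≤-trans (m≤n+∣n-m∣ n m) (+-monoʳ-≤ m d≤o)

pathPower : ℕ → (m : ℕ) → Graph m
pathPower k m = record { adj = near ; sym = near-sym ; irrefl = near-irrefl }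
  where
  near : Fin m → Fin m → Bool
  near u v = not (does (u ≟ v)) ∧ does (∣ toℕ u - toℕ v ∣ ℕ.≤? k)
  near-sym : ∀ u v → near u v ≡ near v u
  near-sym u v = cong₂ (λ e d → not e ∧ does (d ℕ.≤? k))
                   (does-⇔ (mk⇔ sym sym) (u ≟ v) (v ≟ u)) (∣-∣-comm (toℕ u) (toℕ v))
  near-irrefl : ∀ v → near v v ≡ false
  near-irrefl v = cong (λ e → not e ∧ does (∣ toℕ v - toℕ v ∣ ℕ.≤? k)) (dec-true (v ≟ v) refl)

pathPower-adj : ∀ {k m} (u v : Fin m) → toℕ u ≢ toℕ v → ∣ toℕ u - toℕ v ∣ ≤ k →
                adj (pathPower k m) u v ≡ true
pathPower-adj {k} u v u≢v d≤k =
  cong₂ (λ e d → not e ∧ d) (dec-false (u ≟ v) (u≢v ∘ cong toℕ)) (dec-true (_ ℕ.≤? k) d≤k)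

pathPower-nonadj : ∀ {k m} (u v : Fin m) → ¬ ∣ toℕ u - toℕ v ∣ ≤ k → adj (pathPower k m) u v ≡ false
pathPower-nonadj {k} u v d≰k =
  trans (cong (not (does (u ≟ v)) ∧_) (dec-false (_ ℕ.≤? k) d≰k)) (∧-zeroʳ _)

initial : ∀ {m} → ℕ → Fin m → Bool
initial k v = does (suc (toℕ v) ℕ.≤? k)

-- The new vertex of extend is vertex 0, so the path grows at its start.
pathPower-extend : ∀ k m (u v : Fin (suc m)) →
                   adj (pathPower k (suc m)) u v ≡ adj (extend (pathPower k m) (initial k)) u v
pathPower-extend k m zero    zero    = refl
pathPower-extend k m zero    (suc v) = refl
pathPower-extend k m (suc u) zero    = refl
pathPower-extend k m (suc u) (suc v) = refl

pathPower-complete : ∀ k (u v : Fin (suc k)) → adj (pathPower k (suc k)) u v ≡ adj (complete (suc k)) u v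
pathPower-complete k u v =
  trans (cong (not (does (u ≟ v)) ∧_) (dec-true (_ ℕ.≤? k) (∣m-n∣≤o (≤k u v) (≤k v u))))
        (∧-identityʳ _)
  where
  ≤k : ∀ (x y : Fin (suc k)) → toℕ x ≤ toℕ y + k
  ≤k x y = ≤-trans (toℕ≤pred[n] x) (m≤n+m k (toℕ y))

count-initial : ∀ m k → k ≤ m → count {m} (initial k) ≡ k
count-initial m       zero    _         = count-false m
count-initial (suc m) (suc k) (s≤s k≤m) = cong suc (count-initial m k k≤m)

initial-clique : ∀ {k m} → k ≤ m → IsClique (pathPower k m) k (initial k)
initial-clique {k} {m} k≤m = count-initial m k k≤m , pairwise
  where
  ≤k : ∀ x → initial k x ≡ true → ∀ y → toℕ x ≤ toℕ y + k
  ≤k x x<k y = ≤-trans (<⇒≤ (does-true (_ ℕ.≤? k) x<k)) (m≤n+m k (toℕ y))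
  pairwise : ∀ u v → initial k u ≡ true → initial k v ≡ true → u ≢ v → adj (pathPower k m) u v ≡ true
  pairwise u v u<k v<k u≢v =
    pathPower-adj u v (u≢v ∘ toℕ-injective) (∣m-n∣≤o (≤k u u<k v) (≤k v v<k u))

pathPower-ktree : ∀ k j → KTree k (pathPower k (suc (j + k)))
pathPower-ktree k zero    = iso Perm.id base (pathPower-complete k)
pathPower-ktree k (suc j) =
  iso Perm.id (step (initial k) (pathPower-ktree k j) (initial-clique (m≤n+m k (suc j))))
    (pathPower-extend k (suc (j + k)))

pathPower-simplicial : ∀ k j (v : Fin (suc (j + suc k))) →
                       deg (pathPower (suc k) (suc (j + suc k))) v ≡ suc k →
                       toℕ v ≡ 0 ⊎ toℕ v ≡ j + suc k ⊎ j ≡ 0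
pathPower-simplicial k zero    v       _ = inj₂ (inj₂ refl)
pathPower-simplicial k (suc j) zero    _ = inj₁ refl
pathPower-simplicial k (suc j) (suc u) d
  with extend-simplicial {G = pathPower (suc k) (suc (j + suc k))} {initial (suc k)}
         (ktree-minDegree (pathPower-ktree (suc k) j)) u d
... | u∉initial , du with pathPower-simplicial k j u du
...   | inj₁ u≡0           = contradiction (trans (sym u∉initial) (dec-true (_ ℕ.≤? suc k) 1+u≤1+k)) λ ()
  where
  1+u≤1+k : suc (toℕ u) ≤ suc k
  1+u≤1+k = subst (λ x → suc x ≤ suc k) (sym u≡0) (s≤s z≤n)
...   | inj₂ (inj₁ u≡last) = inj₂ (inj₁ (cong suc u≡last))
...   | inj₂ (inj₂ refl)   =
  inj₂ (inj₁ (cong suc (≤-antisym (toℕ≤pred[n] u) k≤u)))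
  where
  k≤u : suc k ≤ toℕ u
  k≤u = ≤-pred (≰⇒> (does-false (_ ℕ.≤? suc k) u∉initial))

pathPower-ends : ∀ k (v : Fin (suc (suc k + k))) → deg (pathPower k (suc (suc k + k))) v ≡ k →
                 pair zero (fromℕ (suc k + k)) v ≡ true
pathPower-ends zero    zero       _ = refl
pathPower-ends zero    (suc zero) _ = refl
pathPower-ends (suc k) v d with pathPower-simplicial k (suc (suc k)) v d
... | inj₁ v≡0 with toℕ-injective {j = zero} v≡0
...   | refl = pair-∋ˡ zero (fromℕ (suc (suc k) + suc k))
pathPower-ends (suc k) v d | inj₂ (inj₁ v≡ℓ) with toℕ-injective (trans v≡ℓ (sym (toℕ-fromℕ _)))
...   | refl = pair-∋ʳ zero v

dominating-≥2 : ∀ {n} (G : Graph n) D → Dominating G D →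
                ∀ d x → D d ≡ true → x ≢ d → adj G d x ≡ false → 2 ≤ count D
dominating-≥2 G D dominating d x Dd x≢d dx with D x in Dx
... | true  = count-≥2 D x d Dx Dd x≢d
... | false with dominating x Dx
...   | u , Du , ux = count-≥2 D u d Du Dd λ { refl → contradiction (trans (sym dx) ux) λ () }

[k+2]*2≡[2+k+k]+2 : ∀ k → (k + 2) * 2 ≡ suc (suc k + k) + 2
[k+2]*2≡[2+k+k]+2 = solve-∀

-- The end vertices are the only simplicial ones, and no single vertex dominates both.
module Tight (k : ℕ) where

  size : ℕ
  size = suc (suc k + k)

  T : Graph size
  T = pathPower k size

  T-ktree : KTree k T
  T-ktree = pathPower-ktree k (suc k)

  centre last : Fin size
  centre = fromℕ< (s≤s (m≤n⇒m≤1+n (m≤m+n k k)))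
  last   = fromℕ (suc k + k)

  toℕ-centre : toℕ centre ≡ k
  toℕ-centre = toℕ-fromℕ< (s≤s (m≤n⇒m≤1+n (m≤m+n k k)))

  far-from-last : ∀ (u : Fin size) → toℕ u ≤ k → ¬ ∣ toℕ u - toℕ last ∣ ≤ k
  far-from-last u u≤k d≤k = 1+n≰n (begin
    suc (k + k)  ≡⟨ sym (toℕ-fromℕ (suc k + k)) ⟩
    toℕ last     ≤⟨ ∣m-n∣≤o⇒n≤m+o d≤k ⟩
    toℕ u + k    ≤⟨ +-monoˡ-≤ k u≤k ⟩
    k + k        ∎)
    where open ≤-Reasoning

  last≢ : ∀ (u : Fin size) → toℕ u ≤ k → last ≢ u
  last≢ u u≤k refl = far-from-last last u≤k (≤-trans (≤-reflexive (∣n-n∣≡0 (toℕ last))) z≤n)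

  centre-last : adj T centre last ≡ false
  centre-last = pathPower-nonadj centre last (far-from-last centre (≤-reflexive toℕ-centre))

  D : Fin size → Bool
  D = pair centre last

  D-independent : Independent T D
  D-independent u v Du Dv with pair-elements centre last u Du | pair-elements centre last v Dv
  ... | inj₁ refl | inj₁ refl = irrefl T centre
  ... | inj₂ refl | inj₂ refl = irrefl T last
  ... | inj₁ refl | inj₂ refl = centre-last
  ... | inj₂ refl | inj₁ refl = trans (Graph.sym T last centre) centre-last

  D-dominating : Dominating T D
  D-dominating v Dv with centre ≟ v | last ≟ v
  ... | no c≢v | no ℓ≢v =
    centre , pair-∋ˡ centre last ,
    pathPower-adj centre v (c≢v ∘ toℕ-injective) (∣m-n∣≤o c≤v+k v≤c+k)
    where
    c≤v+k : toℕ centre ≤ toℕ v + k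
    c≤v+k = ≤-trans (≤-reflexive toℕ-centre) (m≤n+m k (toℕ v))
    v≢last : toℕ v ≢ suc k + k
    v≢last e = ℓ≢v (toℕ-injective (trans (toℕ-fromℕ (suc k + k)) (sym e)))
    v≤c+k : toℕ v ≤ toℕ centre + k
    v≤c+k = subst (λ c → toℕ v ≤ c + k) (sym toℕ-centre)
                  (≤-pred (≤∧≢⇒< (toℕ≤pred[n] v) v≢last))

  needs-two : ∀ D′ → Dominating T D′ → 2 ≤ count D′
  needs-two D′ dominating with some-element
    where
    some-element : Σ (Fin size) λ d → D′ d ≡ true
    some-element with D′ zero in D′0
    ... | true  = zero , D′0
    ... | false = Product.map₂ proj₁ (dominating zero D′0)
  ... | d , D′d with toℕ d ℕ.≤? k
  ...   | yes d≤k = dominating-≥2 T D′ dominating d last D′d (last≢ d d≤k)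
                      (pathPower-nonadj d last (far-from-last d d≤k))
  ...   | no d≰k  = dominating-≥2 T D′ dominating d zero D′d (λ { refl → d≰k z≤n })
                      (pathPower-nonadj d zero (d≰k ∘ subst (_≤ k) (∣-∣-identityʳ (toℕ d))))

  γᵢ≡2 : IsIndepDomNumber T 2
  γᵢ≡2 = ( D , (D-independent , D-dominating)
         , ≤-antisym (count-pair centre last) (needs-two D D-dominating))
       , λ D′ D′-indepDom → needs-two D′ (proj₂ D′-indepDom)

  simplicial≤2 : numDeg T k ≤ 2
  simplicial≤2 = ≤-trans (count-mono ends) (count-pair zero last)
    where
    ends : (λ v → deg T v ≡ᵇ k) ⊆ pair zero last
    ends v d = pathPower-ends k v (does-true (deg T v ℕ.≟ k) d)

  -- The upper bound itself forces a second simplicial vertex.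
  simplicial≥2 : 2 ≤ numDeg T k
  simplicial≥2 = +-cancelˡ-≤ size 2 (numDeg T k)
    (subst (_≤ size + numDeg T k) ([k+2]*2≡[2+k+k]+2 k) (indepDom-upper-bound k size T T-ktree 2 γᵢ≡2))

  attains : (k + 2) * 2 ≡ size + numDeg T k
  attains = trans ([k+2]*2≡[2+k+k]+2 k) (cong (size +_) (≤-antisym simplicial≥2 simplicial≤2))

theorem3 : ((k n : ℕ) (G : Graph n) → KTree k G → (m : ℕ) →
             IsIndepDomNumber G m → (k + 2) * m ≤ n + numDeg G k)
           × ((k : ℕ) → Σ ℕ λ n → Σ (Graph n) λ G → KTree k G ×
             Σ ℕ λ m → IsIndepDomNumber G m × (k + 2) * m ≡ n + numDeg G k)
theorem3 = indepDom-upper-bound , λ k → let open Tight k in size , T , T-ktree , 2 , γᵢ≡2 , attains
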